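{- Let $G$ be a connected bipartite graph with bipartition $(X,Y)$. (i) If $\mathrm{diam}(G)\le 3$, then any two vertices in the same partite set have a common neighbor. (ii) If $G\in\mathcal{G}^{\mathrm{cs}}$, $\mathrm{diam}(G)\le 3$ and $\delta(G)\ge 2$, then for every vertex $v$ with $\deg_G(v)\ge 3$, at most one component of $G-N_G[v]$ has more than one vertex. (iii) If $G\in\mathcal{G}^{\mathrm{cs}}$ and $|V(G)|\ge 5$, then no two vertices of degree two have the same neighborhood.
   Context: All graphs are finite and simple; $\delta(G)$ is the minimum degree, $N_G[v]$ the closed neighborhood of $v$. A weight function on $V(G)$ is a map $w:V(G)\to\mathbb{R}_{>0}$; for $X\subseteq V(G)$ put $w(X)=\sum_{v\in X}w(v)$. A non-empty set $S\subseteq V(G)$ is a weighted safe set of $(G,w)$ if for every component $C$ of the induced subgraph $G[S]$ and every component $D$ of $G-S$ such that some edge joins $C$ and $D$, we have $w(C)\ge w(D)$. It is a connected weighted safe set if moreover $G[S]$ is connected. $\mathrm{s}(G,w)$ (resp. $\mathrm{cs}(G,w)$) is the minimum of $w(S)$ over all weighted safe sets (resp. connected weighted safe sets) $S$ of $(G,w)$. $\mathcal{G}^{\mathrm{cs}}$ denotes the family of all graphs $G$ such that $\mathrm{s}(G,w)=\mathrm{cs}(G,w)$ for every weight function $w$ on $V(G)$. -}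

module Defs where

open import Data.Nat using (ℕ; zero; suc; _+_; _≤_)
open import Data.Bool using (Bool; true; false; if_then_else_; _∨_)
open import Data.Fin using (Fin; zero; suc)
open import Data.Fin.Subset using (Subset; _∈_; _∉_; _⊆_; ∁; ⊤; ∣_∣; Nonempty)
open import Data.Vec using (Vec; []; _∷_; tabulate)
open import Data.Product using (Σ; ∃; _×_; _,_)
open import Relation.Binary.PropositionalEquality using (_≡_)
open import Relation.Nullary using (¬_; does)
open import Data.Fin using (_≟_)

record Graph (n : ℕ) : Set where
  field
    E      : Fin n → Fin n → Bool
    E-sym  : ∀ u v → E u v ≡ E v u
    E-irr  : ∀ v → E v v ≡ false

open Graph public

module _ {n : ℕ} (G : Graph n) where

  Adj : Fin n → Fin n → Set
  Adj u v = E G u v ≡ true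

  N : Fin n → Subset n
  N v = tabulate (λ u → E G v u)

  N[_] : Fin n → Subset n
  N[ v ] = tabulate (λ u → E G v u ∨ does (u ≟ v))

  deg : Fin n → ℕ
  deg v = ∣ N v ∣

  MinDegGe : ℕ → Set
  MinDegGe k = ∀ v → k ≤ deg v

  data PathIn (S : Subset n) : Fin n → Fin n → Set where
    here  : ∀ {v} → v ∈ S → PathIn S v v
    step  : ∀ {u w v} → u ∈ S → Adj u w → PathIn S w v → PathIn S u v

  data Walk : ℕ → Fin n → Fin n → Set where
    here : ∀ {v} → Walk zero v v
    step : ∀ {k u w v} → Adj u w → Walk k w v → Walk (suc k) u v

  Connected : Set
  Connected = (1 ≤ n) × (∀ u v → PathIn ⊤ u v)

  DiamLe : ℕ → Set
  DiamLe d = ∀ u v → ∃ λ k → k ≤ d × Walk k u v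

  IsBipartition : Subset n → Set
  IsBipartition X = ∀ u v → Adj u v → (u ∈ X × v ∉ X) Data.Sum.⊎ (u ∉ X × v ∈ X)
    where import Data.Sum

  InducedConnected : Subset n → Set
  InducedConnected S = ∀ u v → u ∈ S → v ∈ S → PathIn S u v

  IsComponent : Subset n → Subset n → Set
  IsComponent S C =
    C ⊆ S × Nonempty C × InducedConnected C
    × (∀ x y → x ∈ C → y ∈ S → Adj x y → y ∈ C)

wt : {n : ℕ} → (Fin n → ℕ) → Subset n → ℕ
wt {zero}  w []      = 0
wt {suc n} w (b ∷ C) = (if b then w zero else 0) + wt (λ i → w (suc i)) C

module _ {n : ℕ} (G : Graph n) where

  WeightFn : Set
  WeightFn = Σ (Fin n → ℕ) λ w → ∀ v → 1 ≤ w v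

  IsSafe : (Fin n → ℕ) → Subset n → Set
  IsSafe w S =
    Nonempty S ×
    (∀ C D → IsComponent G S C → IsComponent G (∁ S) D →
       (∃ λ x → ∃ λ y → x ∈ C × y ∈ D × Adj G x y) →
       wt w D ≤ wt w C)

  IsConnSafe : (Fin n → ℕ) → Subset n → Set
  IsConnSafe w S = IsSafe w S × InducedConnected G S

  IsSafeNumber : (Fin n → ℕ) → ℕ → Set
  IsSafeNumber w m =
    (∃ λ S → IsSafe w S × wt w S ≡ m) × (∀ S → IsSafe w S → m ≤ wt w S)

  IsConnSafeNumber : (Fin n → ℕ) → ℕ → Set
  IsConnSafeNumber w m =
    (∃ λ S → IsConnSafe w S × wt w S ≡ m) × (∀ S → IsConnSafe w S → m ≤ wt w S)

  InGcs : Set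
  InGcs = ∀ (w : WeightFn) → ∀ a b →
    IsSafeNumber (Data.Product.proj₁ w) a →
    IsConnSafeNumber (Data.Product.proj₁ w) b → a ≡ b
    where import Data.Product

-- (i) and (ii) are parity arguments. In a bipartite graph of diameter at most 3, walks of
-- length 1 and 3 join opposite sides, so distinct vertices on one side have a common
-- neighbour. A component of G - N[v] with two vertices contains a vertex on the side opposite
-- to v; two such vertices in different components would have a common neighbour on the side
-- of v, hence outside N[v], joining the components.
--
-- (iii) Let u ≠ v have the same neighbourhood {a, b}, where a ≁ b by bipartiteness. As G is
-- connected with at least five vertices, some r ∉ {u, v, a, b} is adjacent to a or b, say a.
-- Weight a, u, v by K = 2n + 2, b by K + 1 and all other vertices by 2. Then {a, b} is a
-- safe set of weight 2K + 1: the components of G - {a, b} are {u}, {v} and sets of light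
-- vertices of total weight at most 2n < K, while {a} and {b} weigh at least K. A connected
-- safe set T of weight at most 2K + 1 can neither contain two heavy vertices and a third
-- one, nor miss a component of G - T containing two heavy vertices and a third one.
-- Checking the traces of T on {a, b, u, v} (with r as the third vertex when T = {b, u} or
-- {b, v}) leaves only T = {a, u} and {a, v}, which are outweighed by the component of b.
-- Hence s(G, w) < cs(G, w).
module Submission where

open import Algebra.Properties.CommutativeSemigroup using (x∙yz≈y∙xz)
open import Data.Bool using (Bool; true; false; if_then_else_; _∨_; not)
import Data.Bool as Bool
open import Data.Bool.Properties using (¬-not; not-¬; not-involutive; ∨-zeroʳ)
open import Data.Empty using (⊥)
open import Data.Fin using (Fin; zero; suc; _≟_; fromℕ<)
open import Data.Fin.Properties using (any?; ∀-cons)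
open import Data.Fin.Subset
  using (Subset; _∈_; _∉_; _⊆_; ∁; ⊤; ⁅_⁆; _∪_; _-_; ∣_∣; Nonempty; inside; outside)
  renaming (⊥ to ∅)
open import Data.Fin.Subset.Properties
  using ( _∈?_; ∈⊤; ∣⊤∣≡n; p─⊥≡p; p─q⊆p; x∈p∧x≢y⇒x∈p-y; Empty-unique; ⊆-antisym
        ; x∈∁p⇒x∉p; x∉p⇒x∈∁p; x∈p⇒x∉∁p; x∉∁p⇒x∈p; x∈p∪q⁺; x∈p∪q⁻; x∈⁅x⁆; x∈⁅y⁆⇒x≡y)
open import Data.List using (List; []; _∷_; map; length)
open import Data.List.Membership.Propositional using () renaming (_∈_ to _∈ₗ_; _∉_ to _∉ₗ_)
import Data.List.Relation.Unary.All as All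
open import Data.List.Relation.Unary.All using (All; []; _∷_)
import Data.List.Relation.Unary.Any as Any
open import Data.List.Relation.Unary.AllPairs using ([]; _∷_)
open import Data.List.Relation.Unary.Unique.Propositional using (Unique)
open import Data.Nat using (ℕ; zero; suc; _+_; _*_; _≤_; _<_; z≤n; s≤s)
open import Data.Nat.Induction using (<-rec)
open import Data.Nat.ListAction using (sum)
open import Data.Nat.Properties hiding (_≟_)
open import Data.Product using (∃; ∃₂; _×_; _,_; proj₁; proj₂)
open import Data.Sum using (_⊎_; inj₁; inj₂)
import Data.Sum as Sum
open import Data.Vec using ([]; _∷_; lookup; tabulate; here; there)
open import Data.Vec.Properties using ([]=⇒lookup; lookup⇒[]=; lookup∘tabulate)
open import Effect.Monad using (RawMonad)
open import Function using (id; _∘_; case_of_)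
open import Level using (0ℓ)
open import Relation.Binary.PropositionalEquality
open import Relation.Nullary using (¬_; Dec; does; yes; no; ¬?; contradiction)
open import Relation.Nullary.Decidable
  using (_×-dec_; decidable-stable; dec-true; dec-false; ¬¬-excluded-middle)
open import Relation.Nullary.Negation using (¬¬-Monad)

open import Defs

private
  variable
    n : ℕ

open RawMonad (¬¬-Monad {0ℓ}) using (pure; _>>=_; _<$>_)

∈-tabulate⁺ : ∀ (f : Fin n → Bool) {x} → f x ≡ true → x ∈ tabulate f
∈-tabulate⁺ f {x} fx = lookup⇒[]= x (tabulate f) (trans (lookup∘tabulate f x) fx)

∈-tabulate⁻ : ∀ (f : Fin n → Bool) {x} → x ∈ tabulate f → f x ≡ true
∈-tabulate⁻ f {x} x∈ = trans (sym (lookup∘tabulate f x)) ([]=⇒lookup x∈)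

x∉p-x : ∀ {x : Fin n} {p} → x ∉ p - x
x∉p-x {x = zero}  {_ ∷ _} ()
x∉p-x {x = suc x} {_ ∷ _} (there x∈) = x∉p-x x∈

wt-∅ : ∀ (w : Fin n → ℕ) → wt w ∅ ≡ 0
wt-∅ {zero}  w = refl
wt-∅ {suc n} w = wt-∅ (w ∘ suc)

wt-split : ∀ (w : Fin n → ℕ) p x → wt w p ≡ (if lookup p x then w x else 0) + wt w (p - x)
wt-split w (b ∷ p) zero    =
  cong (λ q → (if b then w zero else 0) + wt (w ∘ suc) q) (sym (p─⊥≡p p))
wt-split w (b ∷ p) (suc x) = begin
  w₀ + wt (w ∘ suc) p                    ≡⟨ cong (w₀ +_) (wt-split (w ∘ suc) p x) ⟩
  w₀ + (wₓ + wt (w ∘ suc) (p - x))       ≡⟨ x∙yz≈y∙xz +-commutativeSemigroup w₀ wₓ _ ⟩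
  wₓ + (w₀ + wt (w ∘ suc) (p - x))       ∎
  where
  open ≡-Reasoning
  w₀ wₓ : ℕ
  w₀ = if b then w zero else 0
  wₓ = if lookup p x then w (suc x) else 0

wt-remove : ∀ (w : Fin n → ℕ) {p x} → x ∈ p → wt w p ≡ w x + wt w (p - x)
wt-remove w {p} {x} x∈p with lookup p x | wt-split w p x | []=⇒lookup x∈p
... | true | split | refl = split

wt-≤-remove : ∀ (w : Fin n → ℕ) p x → wt w p ≤ w x + wt w (p - x)
wt-≤-remove w p x with lookup p x | wt-split w p x
... | true  | split = ≤-reflexive split
... | false | split = ≤-trans (≤-reflexive split) (m≤n+m _ (w x))

w≤wt : ∀ (w : Fin n → ℕ) {p x} → x ∈ p → w x ≤ wt w p
w≤wt w {p} {x} x∈p = ≤-trans (m≤m+n (w x) _) (≤-reflexive (sym (wt-remove w x∈p)))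

wt-≤-sum : ∀ (w : Fin n → ℕ) {p} xs → (∀ {x} → x ∈ p → x ∈ₗ xs) → wt w p ≤ sum (map w xs)
wt-≤-sum w {p} []       p⊆[] =
  ≤-reflexive (trans (cong (wt w) (Empty-unique λ (_ , x∈p) → case p⊆[] x∈p of λ ())) (wt-∅ w))
wt-≤-sum w {p} (x ∷ xs) p⊆x∷xs =
  ≤-trans (wt-≤-remove w p x) (+-monoʳ-≤ (w x) (wt-≤-sum w xs p-x⊆xs))
  where
  p-x⊆xs : ∀ {y} → y ∈ p - x → y ∈ₗ xs
  p-x⊆xs y∈ with p⊆x∷xs (p─q⊆p p ⁅ x ⁆ y∈)
  ... | Any.here refl  = contradiction y∈ x∉p-x
  ... | Any.there y∈xs = y∈xs

sum-≤-wt : ∀ (w : Fin n → ℕ) {p xs} → Unique xs → All (_∈ p) xs → sum (map w xs) ≤ wt w p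
sum-≤-wt w []           []           = z≤n
sum-≤-wt w (x≢xs ∷ !xs) (x∈p ∷ xs⊆p) = ≤-trans
  (+-monoʳ-≤ (w _) (sum-≤-wt w !xs (All.zipWith (λ (y∈p , x≢y) → x∈p∧x≢y⇒x∈p-y y∈p (x≢y ∘ sym))
                                                 (xs⊆p , x≢xs))))
  (≤-reflexive (sym (wt-remove w x∈p)))

wt-≤-* : ∀ (w : Fin n → ℕ) p {c} → (∀ {x} → x ∈ p → w x ≤ c) → wt w p ≤ n * c
wt-≤-* w []                bound = z≤n
wt-≤-* w (inside ∷ p)      bound = +-mono-≤ (bound here) (wt-≤-* (w ∘ suc) p (bound ∘ there))
wt-≤-* w (outside ∷ p) {c} bound = ≤-trans (wt-≤-* (w ∘ suc) p (bound ∘ there)) (m≤n+m _ c)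

∣p∣≡wt : ∀ (p : Subset n) → ∣ p ∣ ≡ wt (λ _ → 1) p
∣p∣≡wt []            = refl
∣p∣≡wt (inside ∷ p)  = cong suc (∣p∣≡wt p)
∣p∣≡wt (outside ∷ p) = ∣p∣≡wt p

sum-map-1≡length : ∀ {A : Set} (xs : List A) → sum (map (λ _ → 1) xs) ≡ length xs
sum-map-1≡length []       = refl
sum-map-1≡length (_ ∷ xs) = cong suc (sum-map-1≡length xs)

∃∉⊎⊆ : ∀ (p : Subset n) xs → (∃ λ x → x ∈ p × x ∉ₗ xs) ⊎ (∀ {x} → x ∈ p → x ∈ₗ xs)
∃∉⊎⊆ p xs with any? (λ x → x ∈? p ×-dec ¬? (Any.any? (x ≟_) xs))
... | yes found = inj₁ found
... | no  none  = inj₂ λ {x} x∈p →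
  decidable-stable (Any.any? (x ≟_) xs) λ x∉xs → none (x , x∈p , x∉xs)

length<∣p∣⇒∃∉ : ∀ {p : Subset n} xs → length xs < ∣ p ∣ → ∃ λ x → x ∈ p × x ∉ₗ xs
length<∣p∣⇒∃∉ {p = p} xs len< with ∃∉⊎⊆ p xs
... | inj₁ found = found
... | inj₂ p⊆xs  = contradiction ∣p∣≤length (<⇒≱ len<)
  where
  ∣p∣≤length : ∣ p ∣ ≤ length xs
  ∣p∣≤length = begin
    ∣ p ∣                   ≡⟨ ∣p∣≡wt p ⟩
    wt (λ _ → 1) p          ≤⟨ wt-≤-sum (λ _ → 1) xs p⊆xs ⟩
    sum (map (λ _ → 1) xs)  ≡⟨ sum-map-1≡length xs ⟩
    length xs               ∎
    where open ≤-Reasoning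

unique⇒length≤∣p∣ : ∀ {p : Subset n} {xs} → Unique xs → All (_∈ p) xs → length xs ≤ ∣ p ∣
unique⇒length≤∣p∣ {p = p} {xs} !xs xs⊆p = begin
  length xs               ≡⟨ sum-map-1≡length xs ⟨
  sum (map (λ _ → 1) xs)  ≤⟨ sum-≤-wt (λ _ → 1) !xs xs⊆p ⟩
  wt (λ _ → 1) p          ≡⟨ ∣p∣≡wt p ⟨
  ∣ p ∣                   ∎
  where open ≤-Reasoning

2≤∣p∣⇒∃≢ : ∀ {p : Subset n} → 2 ≤ ∣ p ∣ → ∃₂ λ x y → x ∈ p × y ∈ p × x ≢ y
2≤∣p∣⇒∃≢ 2≤∣p∣ with length<∣p∣⇒∃∉ [] (≤-trans (s≤s z≤n) 2≤∣p∣)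
... | x , x∈p , _ with length<∣p∣⇒∃∉ (x ∷ []) 2≤∣p∣
...   | y , y∈p , y∉[x] = x , y , x∈p , y∈p , λ x≡y → y∉[x] (Any.here (sym x≡y))

∣p∣≡2⇒pair : ∀ {p : Subset n} → ∣ p ∣ ≡ 2 →
  ∃₂ λ x y → x ≢ y × x ∈ p × y ∈ p × (∀ {z} → z ∈ p → z ≡ x ⊎ z ≡ y)
∣p∣≡2⇒pair {p = p} ∣p∣≡2 with 2≤∣p∣⇒∃≢ (≤-reflexive (sym ∣p∣≡2))
... | x , y , x∈p , y∈p , x≢y = x , y , x≢y , x∈p , y∈p , only
  where
  only : ∀ {z} → z ∈ p → z ≡ x ⊎ z ≡ y
  only {z} z∈p with z ≟ x | z ≟ y
  ... | yes z≡x | _       = inj₁ z≡x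
  ... | no _    | yes z≡y = inj₂ z≡y
  ... | no z≢x  | no z≢y  = contradiction
    (subst (3 ≤_) ∣p∣≡2 (unique⇒length≤∣p∣ {xs = x ∷ y ∷ z ∷ []}
      ((x≢y ∷ (z≢x ∘ sym) ∷ []) ∷ ((z≢y ∘ sym) ∷ []) ∷ [] ∷ []) (x∈p ∷ y∈p ∷ z∈p ∷ [])))
    λ { (s≤s (s≤s ())) }

¬¬-least : ∀ {P : ℕ → Set} {m} → P m → ¬ ¬ (∃ λ k → P k × (∀ {j} → P j → k ≤ j))
¬¬-least {P} {m} = <-rec (λ m → P m → ¬ ¬ Least) least-from m
  where
  Least : Set
  Least = ∃ λ k → P k × (∀ {j} → P j → k ≤ j)
  least-from : ∀ m → (∀ {j} → j < m → P j → ¬ ¬ Least) → P m → ¬ ¬ Least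
  least-from m smaller Pm = ¬¬-excluded-middle {A = ∃ λ j → j < m × P j} >>= λ where
    (yes (j , j<m , Pj)) → smaller j<m Pj
    (no ∄smaller)        → pure (m , Pm , λ {j} Pj → ≮⇒≥ λ j<m → ∄smaller (j , j<m , Pj))

¬¬-dec-∀ : ∀ (P : Fin n → Set) → ¬ ¬ (∀ x → Dec (P x))
¬¬-dec-∀ {zero}  P = pure λ ()
¬¬-dec-∀ {suc n} P = do
  P0?   ← ¬¬-excluded-middle
  Psuc? ← ¬¬-dec-∀ (P ∘ suc)
  pure (∀-cons P0? Psuc?)

module _ (G : Graph n) where

  Adj-sym : ∀ {x y} → Adj G x y → Adj G y x
  Adj-sym {x} {y} x~y = trans (E-sym G y x) x~y

  Adj⇒≢ : ∀ {x y} → Adj G x y → x ≢ y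
  Adj⇒≢ {x} x~x refl = case trans (sym x~x) (E-irr G x) of λ ()

  ∈N⇒Adj : ∀ {v x} → x ∈ N G v → Adj G v x
  ∈N⇒Adj = ∈-tabulate⁻ (E G _)

  Adj⇒∈N : ∀ {v x} → Adj G v x → x ∈ N G v
  Adj⇒∈N = ∈-tabulate⁺ (E G _)

  ∈∁N[]⇒¬Adj : ∀ {v y} → y ∈ ∁ (N[_] G v) → ¬ Adj G v y
  ∈∁N[]⇒¬Adj {v} {y} y∈ v~y =
    x∈∁p⇒x∉p y∈ (∈-tabulate⁺ _ (cong (_∨ does (y ≟ v)) v~y))

  ¬Adj⇒∈∁N[] : ∀ {v y} → ¬ Adj G v y → y ≢ v → y ∈ ∁ (N[_] G v)
  ¬Adj⇒∈∁N[] {v} {y} v≁y y≢v = x∉p⇒x∈∁p λ y∈ →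
    case trans (sym (cong₂ _∨_ (¬-not v≁y) (dec-false (y ≟ v) y≢v))) (∈-tabulate⁻ _ y∈) of λ ()

  module _ {S : Subset n} where

    PathIn-head : ∀ {x y} → PathIn G S x y → x ∈ S
    PathIn-head (here x∈S)     = x∈S
    PathIn-head (step x∈S _ _) = x∈S

    PathIn-last : ∀ {x y} → PathIn G S x y → y ∈ S
    PathIn-last (here y∈S)    = y∈S
    PathIn-last (step _ _ zs) = PathIn-last zs

    _++ᵖ_ : ∀ {x y z} → PathIn G S x y → PathIn G S y z → PathIn G S x z
    here _          ++ᵖ ys = ys
    step x∈S x~z zs ++ᵖ ys = step x∈S x~z (zs ++ᵖ ys)

    PathIn-reverse : ∀ {x y} → PathIn G S x y → PathIn G S y x
    PathIn-reverse (here y∈S)        = here y∈S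
    PathIn-reverse (step x∈S x~z zs) =
      PathIn-reverse zs ++ᵖ step (PathIn-head zs) (Adj-sym x~z) (here x∈S)

    PathIn-first-step : ∀ {x y} → PathIn G S x y → x ≢ y → ∃ λ z → Adj G x z × z ∈ S
    PathIn-first-step (here _)        x≢x = contradiction refl x≢x
    PathIn-first-step (step _ x~z zs) _   = _ , x~z , PathIn-head zs

    PathIn-exit : ∀ {P : Fin n → Set} → (∀ x → Dec (P x)) → ∀ {x y} → PathIn G S x y →
      ¬ P x → P y → ∃₂ λ x′ y′ → ¬ P x′ × P y′ × Adj G x′ y′
    PathIn-exit P? (here _)                ¬Px Py = contradiction Py ¬Px
    PathIn-exit P? (step {w = z} _ x~z zs) ¬Px Py with P? z
    ... | yes Pz  = _ , z , ¬Px , Pz , x~z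
    ... | no  ¬Pz = PathIn-exit P? zs ¬Pz Py

  module _ {S : Subset n} where

    component-⊆ : ∀ {C C′ y} → IsComponent G S C → IsComponent G S C′ → y ∈ C → y ∈ C′ → C ⊆ C′
    component-⊆ {C} {C′} {y} (C⊆S , _ , C-conn , _) (_ , _ , _ , C′-closed) y∈C y∈C′ {x} x∈C =
      along (C-conn y x y∈C x∈C) y∈C′
      where
      along : ∀ {s t} → PathIn G C s t → s ∈ C′ → t ∈ C′
      along (here _)        s∈C′ = s∈C′
      along (step _ s~z zs) s∈C′ = along zs (C′-closed _ _ s∈C′ (C⊆S (PathIn-head zs)) s~z)

    component-≡ : ∀ {C C′ y} → IsComponent G S C → IsComponent G S C′ → y ∈ C → y ∈ C′ → C ≡ C′
    component-≡ C-comp C′-comp y∈C y∈C′ =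
      ⊆-antisym (component-⊆ C-comp C′-comp y∈C y∈C′) (component-⊆ C′-comp C-comp y∈C′ y∈C)

    reachable-component : ∀ {y} → y ∈ S → (∀ x → Dec (PathIn G S y x)) →
      ∃ λ D → IsComponent G S D × y ∈ D
    reachable-component {y} y∈S reach? = D , (D⊆S , (y , y∈D) , D-conn , D-closed) , y∈D
      where
      D : Subset n
      D = tabulate (λ x → does (reach? x))
      reached : ∀ {x} → x ∈ D → PathIn G S y x
      reached {x} x∈D with reach? x | ∈-tabulate⁻ _ x∈D
      ... | yes path | _ = path
      reach⇒∈D : ∀ {x} → PathIn G S y x → x ∈ D
      reach⇒∈D {x} path = ∈-tabulate⁺ _ (dec-true (reach? x) path)
      y∈D : y ∈ D
      y∈D = reach⇒∈D (here y∈S)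
      D⊆S : D ⊆ S
      D⊆S = PathIn-last ∘ reached
      D-closed : ∀ x z → x ∈ D → z ∈ S → Adj G x z → z ∈ D
      D-closed x z x∈D z∈S x~z = reach⇒∈D (reached x∈D ++ᵖ step (D⊆S x∈D) x~z (here z∈S))
      within : ∀ {x z} → x ∈ D → PathIn G S x z → PathIn G D x z
      within x∈D (here _)        = here x∈D
      within x∈D (step _ x~z zs) =
        step x∈D x~z (within (D-closed _ _ x∈D (PathIn-head zs) x~z) zs)
      D-conn : InducedConnected G D
      D-conn x z x∈D z∈D = PathIn-reverse (within y∈D (reached x∈D)) ++ᵖ within y∈D (reached z∈D)

    component-of : ∀ {y} → y ∈ S → ¬ ¬ (∃ λ D → IsComponent G S D × y ∈ D)
    component-of {y} y∈S = reachable-component y∈S <$> ¬¬-dec-∀ (PathIn G S y)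

    component-isolated : ∀ {D x y} → IsComponent G S D → x ∈ D → (∀ {z} → Adj G x z → z ∉ S) →
      y ∈ D → y ≡ x
    component-isolated {x = x} {y} (D⊆S , _ , D-conn , _) x∈D x-isolated y∈D with y ≟ x
    ... | yes y≡x = y≡x
    ... | no  y≢x with PathIn-first-step (D-conn x y x∈D y∈D) (y≢x ∘ sym)
    ...   | z , x~z , z∈D = contradiction (D⊆S z∈D) (x-isolated x~z)

  component-adjacent : ∀ {T D} → Connected G → Nonempty T → IsComponent G (∁ T) D →
    ∃₂ λ x y → x ∈ D × y ∈ T × Adj G x y
  component-adjacent {T} {D} (_ , conn) (t , t∈T) (D⊆∁T , (d , d∈D) , _ , D-closed)
    with PathIn-exit (_∈? ∁ D) (conn d t) (x∈p⇒x∉∁p d∈D)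
           (x∉p⇒x∈∁p λ t∈D → x∈∁p⇒x∉p (D⊆∁T t∈D) t∈T)
  ... | x , y , x∉∁D , y∈∁D , x~y = x , y , x∈D , y∈T , x~y
    where
    x∈D : x ∈ D
    x∈D = x∉∁p⇒x∈p x∉∁D
    y∈T : y ∈ T
    y∈T = decidable-stable (y ∈? T) λ y∉T →
      x∈∁p⇒x∉p y∈∁D (D-closed x y x∈D (x∉p⇒x∈∁p y∉T) x~y)

  ⊤-isConnSafe : Connected G → ∀ w → IsConnSafe G w ⊤
  ⊤-isConnSafe (1≤n , conn) w = ((fromℕ< 1≤n , ∈⊤) , nothing-outside) , λ x y _ _ → conn x y
    where
    nothing-outside : ∀ C D → IsComponent G ⊤ C → IsComponent G (∁ ⊤) D →
      (∃ λ x → ∃ λ y → x ∈ C × y ∈ D × Adj G x y) → wt w D ≤ wt w C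
    nothing-outside _ _ _ (D⊆∁⊤ , (d , d∈D) , _) _ = contradiction ∈⊤ (x∈∁p⇒x∉p (D⊆∁⊤ d∈D))

  connSafe-outweighs-component : ∀ {w T y m} → Connected G → IsConnSafe G w T → y ∉ T →
    (∀ {D} → IsComponent G (∁ T) D → y ∈ D → m ≤ wt w D) → m ≤ wt w T
  connSafe-outweighs-component {w} {T} {y} {m} conn ((T≠∅ , T-safe) , T-conn) y∉T m≤D =
    decidable-stable (m ≤? wt w T) (bound <$> component-of (x∉p⇒x∈∁p y∉T))
    where
    T-comp : IsComponent G T T
    T-comp = id , T≠∅ , T-conn , λ _ _ _ z∈T _ → z∈T
    bound : (∃ λ D → IsComponent G (∁ T) D × y ∈ D) → m ≤ wt w T
    bound (D , D-comp , y∈D) with component-adjacent conn T≠∅ D-comp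
    ... | x , z , x∈D , z∈T , x~z =
      ≤-trans (m≤D D-comp y∈D) (T-safe T D T-comp D-comp (z , x , z∈T , x∈D , Adj-sym x~z))

  -- Minimal weights of (connected) safe sets exist only classically, hence the ¬ ¬.
  InGcs⇒¬¬connSafe≤safe : InGcs G → Connected G → ∀ (w : WeightFn G) {S} →
    IsSafe G (proj₁ w) S → ¬ ¬ (∃ λ T → IsConnSafe G (proj₁ w) T × wt (proj₁ w) T ≤ wt (proj₁ w) S)
  InGcs⇒¬¬connSafe≤safe gcs conn (w , w-pos) {S} S-safe = do
    s , S-attains , s-least ←
      ¬¬-least {P = λ m → ∃ λ S′ → IsSafe G w S′ × wt w S′ ≡ m} (S , S-safe , refl)
    c , T-attains@(T , T-cs , T≡c) , c-least ←
      ¬¬-least {P = λ m → ∃ λ T′ → IsConnSafe G w T′ × wt w T′ ≡ m} (⊤ , ⊤-isConnSafe conn w , refl)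
    let s≡c = gcs (w , w-pos) s c (S-attains , λ S′ S′-safe → s-least (S′ , S′-safe , refl))
                                  (T-attains , λ T′ T′-cs → c-least (T′ , T′-cs , refl))
    pure (T , T-cs , ≤-trans (≤-reflexive (trans T≡c (sym s≡c))) (s-least (S , S-safe , refl)))

module Bipartite {G : Graph n} {X : Subset n} (bip : IsBipartition G X) where

  side : Fin n → Bool
  side x = does (x ∈? X)

  same-part⇒same-side : ∀ {u v} → (u ∈ X × v ∈ X) ⊎ (u ∉ X × v ∉ X) → side u ≡ side v
  same-part⇒same-side {u} {v} (inj₁ (u∈X , v∈X)) =
    trans (dec-true (u ∈? X) u∈X) (sym (dec-true (v ∈? X) v∈X))
  same-part⇒same-side {u} {v} (inj₂ (u∉X , v∉X)) =
    trans (dec-false (u ∈? X) u∉X) (sym (dec-false (v ∈? X) v∉X))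

  Adj⇒side-flips : ∀ {x y} → Adj G x y → side y ≡ not (side x)
  Adj⇒side-flips {x} {y} x~y with bip x y x~y
  ... | inj₁ (x∈X , y∉X) rewrite dec-true (x ∈? X) x∈X | dec-false (y ∈? X) y∉X = refl
  ... | inj₂ (x∉X , y∈X) rewrite dec-false (x ∈? X) x∉X | dec-true (y ∈? X) y∈X = refl

  same-side⇒¬Adj : ∀ {x y} → side x ≡ side y → ¬ Adj G x y
  same-side⇒¬Adj x≡y x~y = not-¬ (sym x≡y) (Adj⇒side-flips x~y)

  Adj²⇒same-side : ∀ {x y z} → Adj G x y → Adj G y z → side z ≡ side x
  Adj²⇒same-side {x} {y} {z} x~y y~z = begin
    side z              ≡⟨ Adj⇒side-flips y~z ⟩
    not (side y)        ≡⟨ cong not (Adj⇒side-flips x~y) ⟩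
    not (not (side x))  ≡⟨ not-involutive (side x) ⟩
    side x              ∎
    where open ≡-Reasoning

  diam≤3⇒common-neighbour : DiamLe G 3 → ∀ {u v} → u ≢ v → side u ≡ side v →
    ∃ λ z → Adj G u z × Adj G v z
  diam≤3⇒common-neighbour diam {u} {v} u≢v same with diam u v
  ... | _ , _ , here                                = contradiction refl u≢v
  ... | _ , _ , step u~v here                       = contradiction u~v (same-side⇒¬Adj same)
  ... | _ , _ , step u~z (step z~v here)            = _ , u~z , Adj-sym G z~v
  ... | _ , _ , step u~x (step x~y (step y~v here)) =
    contradiction y~v (same-side⇒¬Adj (trans (Adj²⇒same-side u~x x~y) same))
  ... | _ , s≤s (s≤s (s≤s ())) , step _ (step _ (step _ (step _ _)))

  connected-meets-side : ∀ {C} → InducedConnected G C → 2 ≤ ∣ C ∣ → ∀ s →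
    ∃ λ y → y ∈ C × side y ≡ s
  connected-meets-side C-conn 2≤∣C∣ s with 2≤∣p∣⇒∃≢ 2≤∣C∣
  ... | x , x′ , x∈C , x′∈C , x≢x′ with PathIn-first-step G (C-conn x x′ x∈C x′∈C) x≢x′
  ...   | z , x~z , z∈C with side x Bool.≟ s
  ...     | yes x≡s = x , x∈C , x≡s
  ...     | no  x≢s = z , z∈C , (begin
    side z        ≡⟨ Adj⇒side-flips x~z ⟩
    not (side x)  ≡⟨ cong not (¬-not x≢s) ⟩
    not (not s)   ≡⟨ not-involutive s ⟩
    s             ∎)
    where open ≡-Reasoning

  diam≤3⇒nontrivial-components-≡ : DiamLe G 3 → ∀ v {C C′} →
    IsComponent G (∁ (N[_] G v)) C → IsComponent G (∁ (N[_] G v)) C′ →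
    2 ≤ ∣ C ∣ → 2 ≤ ∣ C′ ∣ → C ≡ C′
  diam≤3⇒nontrivial-components-≡ diam v C-comp@(C⊆ , _ , C-conn , C-closed)
                                        C′-comp@(_ , _ , C′-conn , C′-closed) 2≤∣C∣ 2≤∣C′∣
    with connected-meets-side C-conn 2≤∣C∣ (not (side v))
       | connected-meets-side C′-conn 2≤∣C′∣ (not (side v))
  ... | y , y∈C , y-side | y′ , y′∈C′ , y′-side with y ≟ y′
  ...   | yes refl = component-≡ G C-comp C′-comp y∈C y′∈C′
  ...   | no  y≢y′ with diam≤3⇒common-neighbour diam y≢y′ (trans y-side (sym y′-side))
  ...     | z , y~z , y′~z =
    component-≡ G C-comp C′-comp (C-closed y z y∈C z∉N[v] y~z) (C′-closed y′ z y′∈C′ z∉N[v] y′~z)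
    where
    z-side : side z ≡ side v
    z-side = trans (Adj⇒side-flips y~z) (trans (cong not y-side) (not-involutive (side v)))
    z∉N[v] : z ∈ ∁ (N[_] G v)
    z∉N[v] = ¬Adj⇒∈∁N[] G (same-side⇒¬Adj (sym z-side))
      λ { refl → ∈∁N[]⇒¬Adj G (C⊆ y∈C) (Adj-sym G y~z) }

record Twins (G : Graph n) (u v a b : Fin n) : Set where
  field
    u≢v : u ≢ v
    a≢b : a ≢ b
    a≁b : ¬ Adj G a b
    u~a : Adj G u a
    u~b : Adj G u b
    v~a : Adj G v a
    v~b : Adj G v b
    N-u : ∀ {x} → Adj G u x → x ≡ a ⊎ x ≡ b
    N-v : ∀ {x} → Adj G v x → x ≡ a ⊎ x ≡ b

swap-hubs : ∀ {G : Graph n} {u v a b} → Twins G u v a b → Twins G u v b a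
swap-hubs {G = G} tw = record
  { u≢v = u≢v ; a≢b = a≢b ∘ sym ; a≁b = a≁b ∘ Adj-sym G
  ; u~a = u~b ; u~b = u~a ; v~a = v~b ; v~b = v~a
  ; N-u = Sum.swap ∘ N-u ; N-v = Sum.swap ∘ N-v }
  where open Twins tw

module TwinWeighting {G : Graph n} (conn : Connected G) {u v a b r} (tw : Twins G u v a b)
  (a~r : Adj G a r) (r≢b : r ≢ b) (r≢u : r ≢ u) (r≢v : r ≢ v) where

  open Twins tw

  u≢a : u ≢ a
  u≢a = Adj⇒≢ G u~a

  u≢b : u ≢ b
  u≢b = Adj⇒≢ G u~b

  v≢a : v ≢ a
  v≢a = Adj⇒≢ G v~a

  v≢b : v ≢ b
  v≢b = Adj⇒≢ G v~b

  K : ℕ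
  K = 2 + n * 2

  w : Fin n → ℕ
  w x = if does (x ≟ a) then K
        else if does (x ≟ b) then suc K
        else if does (x ≟ u) ∨ does (x ≟ v) then K
        else 2

  w-a : w a ≡ K
  w-a rewrite dec-true (a ≟ a) refl = refl

  w-b : w b ≡ suc K
  w-b rewrite dec-false (b ≟ a) (a≢b ∘ sym) | dec-true (b ≟ b) refl = refl

  w-u : w u ≡ K
  w-u rewrite dec-false (u ≟ a) u≢a | dec-false (u ≟ b) u≢b | dec-true (u ≟ u) refl = refl

  w-v : w v ≡ K
  w-v rewrite dec-false (v ≟ a) v≢a | dec-false (v ≟ b) v≢b | dec-true (v ≟ v) refl
            | ∨-zeroʳ (does (v ≟ u)) = refl

  w-other : ∀ {x} → x ≢ a → x ≢ b → x ≢ u → x ≢ v → w x ≡ 2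
  w-other {x} x≢a x≢b x≢u x≢v
    rewrite dec-false (x ≟ a) x≢a | dec-false (x ≟ b) x≢b
          | dec-false (x ≟ u) x≢u | dec-false (x ≟ v) x≢v = refl

  2≤w : ∀ x → 2 ≤ w x
  2≤w x with does (x ≟ a) | does (x ≟ b) | does (x ≟ u) ∨ does (x ≟ v)
  ... | true  | _     | _     = m≤m+n 2 (n * 2)
  ... | false | true  | _     = m≤n⇒m≤1+n (m≤m+n 2 (n * 2))
  ... | false | false | true  = m≤m+n 2 (n * 2)
  ... | false | false | false = ≤-refl

  Heavy : Fin n → Set
  Heavy x = K ≤ w x

  heavy-a : Heavy a
  heavy-a = ≤-reflexive (sym w-a)

  heavy-b : Heavy b
  heavy-b = ≤-trans (n≤1+n K) (≤-reflexive (sym w-b))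

  heavy-u : Heavy u
  heavy-u = ≤-reflexive (sym w-u)

  heavy-v : Heavy v
  heavy-v = ≤-reflexive (sym w-v)

  hubs : Subset n
  hubs = ⁅ a ⁆ ∪ ⁅ b ⁆

  ∈hubs⁺ : ∀ {x} → x ≡ a ⊎ x ≡ b → x ∈ hubs
  ∈hubs⁺ (inj₁ refl) = x∈p∪q⁺ (inj₁ (x∈⁅x⁆ a))
  ∈hubs⁺ (inj₂ refl) = x∈p∪q⁺ (inj₂ (x∈⁅x⁆ b))

  ∈hubs⁻ : ∀ {x} → x ∈ hubs → x ≡ a ⊎ x ≡ b
  ∈hubs⁻ x∈ = Sum.map (x∈⁅y⁆⇒x≡y a) (x∈⁅y⁆⇒x≡y b) (x∈p∪q⁻ ⁅ a ⁆ ⁅ b ⁆ x∈)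

  wt-hubs : wt w hubs ≤ K + suc K
  wt-hubs = begin
    wt w hubs        ≤⟨ wt-≤-sum w (a ∷ b ∷ []) (Sum.[ Any.here , Any.there ∘ Any.here ]′ ∘ ∈hubs⁻) ⟩
    w a + (w b + 0)  ≡⟨ cong₂ _+_ w-a (trans (+-identityʳ (w b)) w-b) ⟩
    K + suc K        ∎
    where open ≤-Reasoning

  lone-twin≤K : ∀ {D p} → IsComponent G (∁ hubs) D → p ∈ D →
    (∀ {x} → Adj G p x → x ≡ a ⊎ x ≡ b) → w p ≡ K → wt w D ≤ K
  lone-twin≤K {D} {p} D-comp p∈D N-p w-p = begin
    wt w D   ≤⟨ wt-≤-sum w (p ∷ []) (Any.here ∘ component-isolated G D-comp p∈D p-isolated) ⟩
    w p + 0  ≡⟨ trans (+-identityʳ (w p)) w-p ⟩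
    K        ∎
    where
    open ≤-Reasoning
    p-isolated : ∀ {x} → Adj G p x → x ∉ ∁ hubs
    p-isolated = x∈p⇒x∉∁p ∘ ∈hubs⁺ ∘ N-p

  outside-hubs≤K : ∀ {D} → IsComponent G (∁ hubs) D → wt w D ≤ K
  outside-hubs≤K {D} D-comp with u ∈? D | v ∈? D
  ... | yes u∈D | _       = lone-twin≤K D-comp u∈D N-u w-u
  ... | _       | yes v∈D = lone-twin≤K D-comp v∈D N-v w-v
  ... | no  u∉D | no  v∉D = ≤-trans (wt-≤-* w D light) (m≤n+m (n * 2) 2)
    where
    light : ∀ {x} → x ∈ D → w x ≤ 2
    light {x} x∈D = ≤-reflexive
      (w-other (x∉hubs ∘ inj₁) (x∉hubs ∘ inj₂) (λ { refl → u∉D x∈D }) (λ { refl → v∉D x∈D }))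
      where
      x∉hubs : ¬ (x ≡ a ⊎ x ≡ b)
      x∉hubs = x∈∁p⇒x∉p (proj₁ D-comp x∈D) ∘ ∈hubs⁺

  hubs-safe : IsSafe G w hubs
  hubs-safe = (a , ∈hubs⁺ (inj₁ refl)) , λ C D C-comp D-comp _ →
    ≤-trans (outside-hubs≤K D-comp) (K≤inside C-comp)
    where
    K≤inside : ∀ {C} → IsComponent G hubs C → K ≤ wt w C
    K≤inside (C⊆hubs , (c , c∈C) , _) = ≤-trans
      (Sum.[ (λ { refl → heavy-a }) , (λ { refl → heavy-b }) ] (∈hubs⁻ (C⊆hubs c∈C)))
      (w≤wt w c∈C)

  module _ {T : Subset n} (T-cs : IsConnSafe G w T) (T-light : wt w T ≤ K + suc K) where

    T-conn : InducedConnected G T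
    T-conn = proj₂ T-cs

    spread : ∀ {D x y} → IsComponent G (∁ T) D → x ∈ D → y ∉ T → Adj G x y → y ∈ D
    spread (_ , _ , _ , D-closed) x∈D y∉T x~y = D-closed _ _ x∈D (x∉p⇒x∈∁p y∉T) x~y

    two-heavies-and-one-more : ∀ {x y z} → Heavy x → Heavy y → K + suc K < w x + (w y + (w z + 0))
    two-heavies-and-one-more {x} {y} {z} x-heavy y-heavy = begin-strict
      K + suc K                ≡⟨ +-suc K K ⟩
      suc (K + K)              <⟨ n<1+n _ ⟩
      2 + (K + K)              ≡⟨ +-comm 2 (K + K) ⟩
      K + K + 2                ≡⟨ +-assoc K K 2 ⟩
      K + (K + 2)              ≤⟨ +-mono-≤ x-heavy (+-mono-≤ y-heavy (+-monoˡ-≤ 0 (2≤w z))) ⟩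
      w x + (w y + (w z + 0))  ∎
      where open ≤-Reasoning

    ¬heavy-pair-inside : ∀ {x y z} → Heavy x → Heavy y → x ≢ y → x ≢ z → y ≢ z →
      x ∈ T → y ∈ T → z ∈ T → ⊥
    ¬heavy-pair-inside {x} {y} {z} x-heavy y-heavy x≢y x≢z y≢z x∈T y∈T z∈T =
      <⇒≱ (two-heavies-and-one-more {x} {y} {z} x-heavy y-heavy) (≤-trans
        (sum-≤-wt w ((x≢y ∷ x≢z ∷ []) ∷ (y≢z ∷ []) ∷ [] ∷ []) (x∈T ∷ y∈T ∷ z∈T ∷ []))
        T-light)

    ¬heavy-pair-outside : ∀ {x y z} → Heavy x → Heavy y → x ≢ y → x ≢ z → y ≢ z → x ∉ T →
      (∀ {D} → IsComponent G (∁ T) D → x ∈ D → y ∈ D × z ∈ D) → ⊥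
    ¬heavy-pair-outside {x} {y} {z} x-heavy y-heavy x≢y x≢z y≢z x∉T reach =
      <⇒≱ (two-heavies-and-one-more {x} {y} {z} x-heavy y-heavy) (≤-trans
        (connSafe-outweighs-component G conn T-cs x∉T λ D-comp x∈D →
          let y∈D , z∈D = reach D-comp x∈D in
          sum-≤-wt w ((x≢y ∷ x≢z ∷ []) ∷ (y≢z ∷ []) ∷ [] ∷ []) (x∈D ∷ y∈D ∷ z∈D ∷ []))
        T-light)

    ¬both-hubs-in : a ∈ T → b ∈ T → ⊥
    ¬both-hubs-in a∈T b∈T with PathIn-first-step G (T-conn a b a∈T b∈T) a≢b
    ... | z , a~z , z∈T =
      ¬heavy-pair-inside heavy-a heavy-b a≢b (Adj⇒≢ G a~z) (λ { refl → a≁b a~z }) a∈T b∈T z∈T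

    ¬hubs-and-twin-outside : ∀ {p} → Heavy p → Adj G p a → Adj G p b →
      a ∉ T → b ∉ T → p ∉ T → ⊥
    ¬hubs-and-twin-outside p-heavy p~a p~b a∉T b∉T p∉T =
      ¬heavy-pair-outside heavy-a p-heavy (Adj⇒≢ G p~a ∘ sym) a≢b (Adj⇒≢ G p~b) a∉T λ D-comp a∈D →
        let p∈D = spread D-comp a∈D p∉T (Adj-sym G p~a) in p∈D , spread D-comp p∈D b∉T p~b

    ¬no-hub-in : a ∉ T → b ∉ T → ⊥
    ¬no-hub-in a∉T b∉T with u ∈? T | v ∈? T
    ... | yes u∈T | yes v∈T with PathIn-first-step G (T-conn u v u∈T v∈T) u≢v
    ...   | z , u~z , z∈T = Sum.[ (λ { refl → a∉T z∈T }) , (λ { refl → b∉T z∈T }) ]′ (N-u u~z)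
    ¬no-hub-in a∉T b∉T | no u∉T | _      = ¬hubs-and-twin-outside heavy-u u~a u~b a∉T b∉T u∉T
    ¬no-hub-in a∉T b∉T | _      | no v∉T = ¬hubs-and-twin-outside heavy-v v~a v~b a∉T b∉T v∉T

    ¬hub-a-and-twin-in : ∀ {p q} → Adj G p a → w p ≡ K → Adj G q a → Adj G q b → w q ≡ K →
      q ≢ p → a ∈ T → b ∉ T → p ∈ T → ⊥
    ¬hub-a-and-twin-in {p} {q} p~a w-p q~a q~b w-q q≢p a∈T b∉T p∈T with ∃∉⊎⊆ T (a ∷ p ∷ [])
    ... | inj₁ (x , x∈T , x∉ap) = ¬heavy-pair-inside heavy-a (≤-reflexive (sym w-p))
      (Adj⇒≢ G p~a ∘ sym) (x∉ap ∘ Any.here ∘ sym) (x∉ap ∘ Any.there ∘ Any.here ∘ sym) a∈T p∈T x∈T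
    ... | inj₂ T⊆ap = contradiction (begin-strict
      K + (K + 0)      <⟨ n<1+n _ ⟩
      suc K + (K + 0)  ≡⟨ cong₂ (λ m m′ → m + (m′ + 0)) w-b w-q ⟨
      w b + (w q + 0)  ≤⟨ connSafe-outweighs-component G conn T-cs b∉T b-reaches-q ⟩
      wt w T           ≤⟨ wt-≤-sum w (a ∷ p ∷ []) T⊆ap ⟩
      w a + (w p + 0)  ≡⟨ cong₂ (λ m m′ → m + (m′ + 0)) w-a w-p ⟩
      K + (K + 0)      ∎) (<-irrefl refl)
      where
      open ≤-Reasoning
      q∉T : q ∉ T
      q∉T q∈T with T⊆ap q∈T
      ... | Any.here q≡a             = Adj⇒≢ G q~a q≡a
      ... | Any.there (Any.here q≡p) = q≢p q≡p
      b-reaches-q : ∀ {D} → IsComponent G (∁ T) D → b ∈ D → w b + (w q + 0) ≤ wt w D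
      b-reaches-q D-comp b∈D = sum-≤-wt w ((Adj⇒≢ G q~b ∘ sym ∷ []) ∷ [] ∷ [])
        (b∈D ∷ spread D-comp b∈D q∉T (Adj-sym G q~b) ∷ [])

    ¬hub-b-and-twin-in : ∀ {p q} → Adj G p b → Heavy p → Adj G q a → Heavy q → q ≢ p →
      r ≢ p → r ≢ q → a ∉ T → b ∈ T → p ∈ T → ⊥
    ¬hub-b-and-twin-in {p} {q} p~b p-heavy q~a q-heavy q≢p r≢p r≢q a∉T b∈T p∈T
      with ∃∉⊎⊆ T (b ∷ p ∷ [])
    ... | inj₁ (x , x∈T , x∉bp) = ¬heavy-pair-inside heavy-b p-heavy
      (Adj⇒≢ G p~b ∘ sym) (x∉bp ∘ Any.here ∘ sym) (x∉bp ∘ Any.there ∘ Any.here ∘ sym) b∈T p∈T x∈T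
    ... | inj₂ T⊆bp =
      ¬heavy-pair-outside heavy-a q-heavy (Adj⇒≢ G q~a ∘ sym) (Adj⇒≢ G a~r) (r≢q ∘ sym) a∉T
        λ D-comp a∈D → spread D-comp a∈D q∉T (Adj-sym G q~a) , spread D-comp a∈D r∉T a~r
      where
      q∉T : q ∉ T
      q∉T q∈T with T⊆bp q∈T
      ... | Any.here refl            = a≁b (Adj-sym G q~a)
      ... | Any.there (Any.here q≡p) = q≢p q≡p
      r∉T : r ∉ T
      r∉T r∈T with T⊆bp r∈T
      ... | Any.here r≡b             = r≢b r≡b
      ... | Any.there (Any.here r≡p) = r≢p r≡p

    ¬only-hub-a-in : a ∈ T → b ∉ T → ⊥
    ¬only-hub-a-in a∈T b∉T with u ∈? T | v ∈? T
    ... | yes u∈T | _       = ¬hub-a-and-twin-in u~a w-u v~a v~b w-v (u≢v ∘ sym) a∈T b∉T u∈T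
    ... | no  _   | yes v∈T = ¬hub-a-and-twin-in v~a w-v u~a u~b w-u u≢v a∈T b∉T v∈T
    ... | no  u∉T | no  v∉T =
      ¬heavy-pair-outside heavy-b heavy-u (Adj⇒≢ G u~b ∘ sym) (Adj⇒≢ G v~b ∘ sym) u≢v b∉T
        λ D-comp b∈D → spread D-comp b∈D u∉T (Adj-sym G u~b) , spread D-comp b∈D v∉T (Adj-sym G v~b)

    ¬only-hub-b-in : a ∉ T → b ∈ T → ⊥
    ¬only-hub-b-in a∉T b∈T with u ∈? T | v ∈? T
    ... | yes u∈T | _       = ¬hub-b-and-twin-in u~b heavy-u v~a heavy-v (u≢v ∘ sym) r≢u r≢v a∉T b∈T u∈T
    ... | no  _   | yes v∈T = ¬hub-b-and-twin-in v~b heavy-v u~a heavy-u u≢v r≢v r≢u a∉T b∈T v∈T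
    ... | no  u∉T | no  v∉T =
      ¬heavy-pair-outside heavy-a heavy-u (Adj⇒≢ G u~a ∘ sym) (Adj⇒≢ G v~a ∘ sym) u≢v a∉T
        λ D-comp a∈D → spread D-comp a∈D u∉T (Adj-sym G u~a) , spread D-comp a∈D v∉T (Adj-sym G v~a)

    ¬light-connSafe : ⊥
    ¬light-connSafe with a ∈? T | b ∈? T
    ... | yes a∈T | yes b∈T = ¬both-hubs-in a∈T b∈T
    ... | no  a∉T | no  b∉T = ¬no-hub-in a∉T b∉T
    ... | yes a∈T | no  b∉T = ¬only-hub-a-in a∈T b∉T
    ... | no  a∉T | yes b∈T = ¬only-hub-b-in a∉T b∈T

  twins-with-outer-neighbour⇒¬InGcs : ¬ InGcs G
  twins-with-outer-neighbour⇒¬InGcs gcs =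
    InGcs⇒¬¬connSafe≤safe G gcs conn (w , λ x → ≤-trans (s≤s z≤n) (2≤w x)) hubs-safe
      λ (T , T-cs , T≤hubs) → ¬light-connSafe T-cs (≤-trans T≤hubs wt-hubs)

connected-twins⇒¬InGcs : ∀ {G : Graph n} {u v a b} → Connected G → 5 ≤ n → Twins G u v a b →
  ¬ InGcs G
connected-twins⇒¬InGcs {n} {G} {u} {v} {a} {b} conn 5≤n tw =
  let r₀ , _ , r₀∉Q = length<∣p∣⇒∃∉ {p = ⊤} Q (subst (4 <_) (sym (∣⊤∣≡n n)) 5≤n)
  in edge-into-Q (PathIn-exit G (λ x → Any.any? (x ≟_) Q) (proj₂ conn r₀ u) r₀∉Q (Any.here refl))
  where
  open Twins tw
  Q : List (Fin n)
  Q = u ∷ v ∷ a ∷ b ∷ []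
  hub∈Q : ∀ {x} → x ≡ a ⊎ x ≡ b → x ∈ₗ Q
  hub∈Q (inj₁ refl) = Any.there (Any.there (Any.here refl))
  hub∈Q (inj₂ refl) = Any.there (Any.there (Any.there (Any.here refl)))
  edge-into-Q : (∃₂ λ x y → x ∉ₗ Q × y ∈ₗ Q × Adj G x y) → ¬ InGcs G
  edge-into-Q (r , _ , r∉Q , Any.here refl , r~u) =
    contradiction (hub∈Q (N-u (Adj-sym G r~u))) r∉Q
  edge-into-Q (r , _ , r∉Q , Any.there (Any.here refl) , r~v) =
    contradiction (hub∈Q (N-v (Adj-sym G r~v))) r∉Q
  edge-into-Q (r , _ , r∉Q , Any.there (Any.there (Any.here refl)) , r~a) =
    TwinWeighting.twins-with-outer-neighbour⇒¬InGcs conn tw (Adj-sym G r~a)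
      (r∉Q ∘ Any.there ∘ Any.there ∘ Any.there ∘ Any.here) (r∉Q ∘ Any.here) (r∉Q ∘ Any.there ∘ Any.here)
  edge-into-Q (r , _ , r∉Q , Any.there (Any.there (Any.there (Any.here refl))) , r~b) =
    TwinWeighting.twins-with-outer-neighbour⇒¬InGcs conn (swap-hubs tw) (Adj-sym G r~b)
      (r∉Q ∘ Any.there ∘ Any.there ∘ Any.here) (r∉Q ∘ Any.here) (r∉Q ∘ Any.there ∘ Any.here)

module _ {G : Graph n} {X : Subset n} (bip : IsBipartition G X) where
  open Bipartite {G = G} {X = X} bip

  shared-degree-two-neighbourhood⇒Twins : ∀ {u v} → u ≢ v → deg G u ≡ 2 → N G u ≡ N G v →
    ∃₂ λ a b → Twins G u v a b
  shared-degree-two-neighbourhood⇒Twins {u} {v} u≢v deg-u Nu≡Nv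
    with ∣p∣≡2⇒pair {p = N G u} deg-u
  ... | a , b , a≢b , a∈Nu , b∈Nu , Nu⊆ab = a , b , record
    { u≢v = u≢v ; a≢b = a≢b
    ; a≁b = same-side⇒¬Adj (sym (Adj²⇒same-side (Adj-sym G u~a) u~b))
    ; u~a = u~a ; u~b = u~b
    ; v~a = ∈N⇒Adj G (subst (a ∈_) Nu≡Nv a∈Nu) ; v~b = ∈N⇒Adj G (subst (b ∈_) Nu≡Nv b∈Nu)
    ; N-u = Nu⊆ab ∘ Adj⇒∈N G
    ; N-v = Nu⊆ab ∘ subst (_ ∈_) (sym Nu≡Nv) ∘ Adj⇒∈N G }
    where
    u~a : Adj G u a
    u~a = ∈N⇒Adj G a∈Nu
    u~b : Adj G u b
    u~b = ∈N⇒Adj G b∈Nu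

lemma5p1 : ∀ (n : ℕ) (G : Graph n) (X : Subset n) →
    Connected G → IsBipartition G X →
    -- (i)
    (DiamLe G 3 → ∀ u v → u ≢ v → ((u ∈ X × v ∈ X) ⊎ (u ∉ X × v ∉ X)) →
      ∃ λ z → Adj G u z × Adj G v z)
    ×
    -- (ii)
    (InGcs G → DiamLe G 3 → MinDegGe G 2 →
      ∀ v → 3 ≤ deg G v →
      ∀ C C' → IsComponent G (∁ (N[_] G v)) C →
        IsComponent G (∁ (N[_] G v)) C' →
        2 ≤ ∣ C ∣ → 2 ≤ ∣ C' ∣ → C ≡ C')
    ×
    -- (iii)
    (InGcs G → 5 ≤ n →
      ∀ u v → u ≢ v → deg G u ≡ 2 → deg G v ≡ 2 → ¬ (N G u ≡ N G v))
lemma5p1 n G X conn bip =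
  (λ diam u v u≢v same-part → diam≤3⇒common-neighbour diam u≢v (same-part⇒same-side same-part)) ,
  (λ _ diam _ v _ C C′ → diam≤3⇒nontrivial-components-≡ diam v) ,
  (λ gcs 5≤n u v u≢v deg-u _ Nu≡Nv →
    let a , b , tw = shared-degree-two-neighbourhood⇒Twins bip u≢v deg-u Nu≡Nv
    in connected-twins⇒¬InGcs conn 5≤n tw gcs)
  where open Bipartite bip
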